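{- For every $P\in\mathcal P_n$, we have $$\mathrm{Peak}(P)=\mathrm{Peak}(\xi(P)).$$
   Context: All paths are lattice paths with steps $N=(0,1)$ and $E=(1,0)$ starting at the origin. $\mathcal P_n$ is the set of Dyck path prefixes of length $n$ (paths of $n$ steps never going below the line $y=x$), and $\mathcal G_n$ is the set of Grand Dyck paths of length $n$ (paths of $n$ steps ending at $(\lceil n/2\rceil,\lfloor n/2\rfloor)$). A peak is an occurrence of $NE$; labelling the vertices of a path from $0$ to $n$ starting at the origin, $\mathrm{Peak}(P)$ is the set of labels of the vertices in the middle of a peak. The bijection $\xi:\mathcal P_n\to\mathcal G_n$ is defined as follows: given $P\in\mathcal P_n$, match each $N$ step with the $E$ step facing it (the segment of slope $1$ from the midpoint of $N$ to the midpoint of $E$ stays below the path; equivalently, $N$s and $E$s are matched as opening and closing parentheses). If $j$ steps are unmatched (necessarily all $N$ steps), $\xi(P)$ is obtained by changing the first $\lceil j/2\rceil$ unmatched $N$ steps into $E$ steps. -}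

module Defs where

open import Data.Nat using (ℕ; zero; suc; _+_; _≤_; _<_; s≤s)
open import Data.Bool using (Bool; true; false)
open import Data.List using (List; []; _∷_; length; take; reverse)
open import Data.List.Membership.DecPropositional using ()
open import Data.Vec using (Vec; []; _∷_; lookup; take; toList)
open import Data.Fin using (Fin; toℕ; fromℕ<)
open import Data.Product using (_×_; Σ; ∃; _,_)
open import Relation.Binary.PropositionalEquality using (_≡_)
open import Data.Unit using (⊤)
open import Data.Empty using (⊥)

-- Steps: N = (0,1), E = (1,0)
data Step : Set where
  N E : Step

Path : ℕ → Set
Path n = Vec Step n

#N : ∀ {n} → Path n → ℕ
#N [] = 0
#N (N ∷ p) = suc (#N p)
#N (E ∷ p) = #N p

#E : ∀ {n} → Path n → ℕ
#E [] = 0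
#E (N ∷ p) = #E p
#E (E ∷ p) = suc (#E p)

-- Dyck path prefix: no prefix has more E steps than N steps
-- (the path never goes below y = x).
IsDyckPrefix : ∀ {n} → Path n → Set
IsDyckPrefix {n} p = ∀ (k : ℕ) (k≤n : k ≤ n) → #E (take' k k≤n p) ≤ #N (take' k k≤n p)
  where
  take' : ∀ {m} (k : ℕ) → k ≤ m → Path m → Path k
  take' zero _ _ = []
  take' (suc k) (s≤s k≤m) (s ∷ q) = s ∷ take' k k≤m q

⌈half⌉ : ℕ → ℕ
⌈half⌉ zero = zero
⌈half⌉ (suc zero) = suc zero
⌈half⌉ (suc (suc j)) = suc (⌈half⌉ j)

-- Parenthesis matching: scan steps (with index i of the step, 0-based),
-- keeping a stack of indices of currently unmatched N steps.
-- An E step is matched with the most recent unmatched N (pops the stack);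
-- an E step with empty stack stays unmatched (never happens for Dyck prefixes).
scan : ∀ {n} → ℕ → List ℕ → Path n → List ℕ
scan i st [] = st
scan i st (N ∷ p) = scan (suc i) (i ∷ st) p
scan i [] (E ∷ p) = scan (suc i) [] p
scan i (_ ∷ st) (E ∷ p) = scan (suc i) st p

-- indices (0-based, increasing) of the unmatched N steps
unmatchedN : ∀ {n} → Path n → List ℕ
unmatchedN p = reverse (scan 0 [] p)

open import Data.List.Membership.Propositional using (_∈_)
open import Data.Nat using (_≟_)
open import Data.List.Relation.Unary.Any using (any?)
open import Relation.Nullary using (Dec; yes; no)

flipAt : ∀ {n} → ℕ → List ℕ → Path n → Path n
flipAt i xs [] = []
flipAt i xs (s ∷ p) with any? (i ≟_) xs
... | yes _ = E ∷ flipAt (suc i) xs p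
... | no _ = s ∷ flipAt (suc i) xs p

ξ : ∀ {n} → Path n → Path n
ξ p = flipAt 0 (Data.List.take (⌈half⌉ (length u)) u) p
  where u = unmatchedN p

-- Peak(P): the set of labels i of vertices (labelled 0..n from the origin)
-- that are in the middle of a peak NE, i.e. the step ending at vertex i is N
-- and the step starting at vertex i is E.
IsPeak : ∀ {n} → Path n → ℕ → Set
IsPeak (N ∷ E ∷ q) (suc zero) = ⊤
IsPeak (_ ∷ q) (suc (suc k)) = IsPeak q (suc k)
IsPeak _ _ = ⊥

module Submission where

-- Call a position x of a path P *unmatched* if it is an N step that
-- is left on the stack by the parenthesis matching `scan`.  The matching
-- has three local properties (established via an invariant of `scan`):
--   (a) an unmatched step is an N step;
--   (b) an unmatched step is never immediately followed by an E step
--       (that E would be matched with it);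
--   (c) an N step immediately followed by an unmatched step is unmatched;
-- and it lists the unmatched positions in increasing order, so that every
-- prefix F of that list is downward closed among the unmatched positions.
-- Now flip the steps of such an F into E steps.  A peak NE at positions
-- (m, m+1) of P survives: by (b) m ∉ F and by (a) m+1 ∉ F.  Conversely a
-- peak of the flipped path has an unflipped N at m, and m+1 ∉ F because
-- otherwise (c) and downward closure would force m ∈ F.

open import Defs
open import Data.Nat using (ℕ; zero; suc; _+_; _<_; _>_; _≟_)
open import Data.Nat.Properties
  using (+-identityʳ; +-suc; n<1+n; m<n⇒m<1+n; ≤-<-trans; <-asym; <-irrefl; suc-injective)
open import Data.List using (List; []; _∷_; take; reverse; length)
open import Data.List.Properties using (unfold-reverse)
open import Data.List.Membership.Propositional using (_∈_; _∉_)
open import Data.List.Relation.Unary.Any using (here; there; any?)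
open import Data.List.Relation.Unary.Any.Properties using (reverse⁺; reverse⁻)
open import Data.List.Relation.Unary.All as All using (All; []; _∷_)
open import Data.List.Relation.Unary.AllPairs using (AllPairs; []; _∷_)
import Data.List.Relation.Unary.AllPairs.Properties as AllPairs
open import Data.List.Relation.Binary.Sublist.Propositional using (lookup)
open import Data.List.Relation.Binary.Sublist.Propositional.Properties using (take-⊆)
open import Data.Vec using ([]; _∷_)
open import Data.Maybe using (Maybe; just; nothing)
open import Data.Product using (_×_; _,_)
open import Data.Sum using (_⊎_; inj₁; inj₂)
open import Data.Empty using (⊥-elim)
open import Data.Unit using (tt)
open import Function using (id; _∘_; flip; case_of_)
open import Function.Bundles using (_⇔_; mk⇔)
import Function.Properties.Equivalence as ⇔
open import Relation.Binary.Core using (Rel)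
open import Relation.Nullary using (¬_; yes; no)
open import Relation.Binary.PropositionalEquality using (_≡_; _≢_; refl; sym; trans; cong; subst; subst₂)

nth : ∀ {n} → Path n → ℕ → Maybe Step
nth []      _       = nothing
nth (s ∷ p) zero    = just s
nth (s ∷ p) (suc k) = nth p k

nth-end : ∀ {n} (p : Path n) → nth p n ≡ nothing
nth-end []      = refl
nth-end (s ∷ p) = nth-end p

-- A peak at vertex m+1 is an N step at position m followed by an E step.
NE-at : ∀ {n} → Path n → ℕ → Set
NE-at p m = nth p m ≡ just N × nth p (suc m) ≡ just E

noPeakAtOrigin : ∀ {n} (p : Path n) → ¬ IsPeak p 0
noPeakAtOrigin []          ()
noPeakAtOrigin (N ∷ [])    ()
noPeakAtOrigin (N ∷ N ∷ _) ()
noPeakAtOrigin (N ∷ E ∷ _) ()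
noPeakAtOrigin (E ∷ _)     ()

peak-shift : ∀ {n} s t (p : Path n) m → IsPeak (s ∷ t ∷ p) (suc (suc m)) ≡ IsPeak (t ∷ p) (suc m)
peak-shift N N p m = refl
peak-shift N E p m = refl
peak-shift E N p m = refl
peak-shift E E p m = refl

peak⇒NE : ∀ {n} (p : Path n) m → IsPeak p (suc m) → NE-at p m
peak⇒NE (N ∷ E ∷ p) zero    _ = refl , refl
peak⇒NE (N ∷ N ∷ p) zero    ()
peak⇒NE (E ∷ t ∷ p) zero    ()
peak⇒NE (s ∷ t ∷ p) (suc m) h = peak⇒NE (t ∷ p) m (subst id (peak-shift s t p m) h)
peak⇒NE (N ∷ [])    zero    ()
peak⇒NE (E ∷ [])    zero    ()
peak⇒NE (N ∷ [])    (suc m) ()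
peak⇒NE (E ∷ [])    (suc m) ()
peak⇒NE []          _       ()

NE⇒peak : ∀ {n} (p : Path n) m → NE-at p m → IsPeak p (suc m)
NE⇒peak (N ∷ E ∷ p) zero    _        = tt
NE⇒peak (s ∷ t ∷ p) (suc m) h        = subst id (sym (peak-shift s t p m)) (NE⇒peak (t ∷ p) m h)
NE⇒peak (N ∷ N ∷ p) zero    (_ , ())
NE⇒peak (E ∷ t ∷ p) zero    (() , _)
NE⇒peak (s ∷ [])    zero    (_ , ())
NE⇒peak (s ∷ [])    (suc m) (() , _)
NE⇒peak []          _       (() , _)

peak⇔NE : ∀ {n} (p : Path n) m → IsPeak p (suc m) ⇔ NE-at p m
peak⇔NE p m = mk⇔ (peak⇒NE p m) (NE⇒peak p m)

-- flipAt i xs p treats p as starting at position i, so the step at offset k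
-- is governed by whether i + k is listed; dropping a step shifts the start.
flipAt-tail : ∀ {n} i xs s (p : Path n) k → nth (flipAt i xs (s ∷ p)) (suc k) ≡ nth (flipAt (suc i) xs p) k
flipAt-tail i xs s p k with any? (i ≟_) xs
... | yes _ = refl
... | no  _ = refl

flipAt-∉ : ∀ {n} i xs (p : Path n) k → (i + k) ∉ xs → nth (flipAt i xs p) k ≡ nth p k
flipAt-∉ i xs [] k _ = refl
flipAt-∉ i xs (s ∷ p) zero i∉ with any? (i ≟_) xs
... | yes i∈ = ⊥-elim (i∉ (subst (_∈ xs) (sym (+-identityʳ i)) i∈))
... | no  _  = refl
flipAt-∉ i xs (s ∷ p) (suc k) i+k∉ =
  trans (flipAt-tail i xs s p k) (flipAt-∉ (suc i) xs p k (i+k∉ ∘ subst (_∈ xs) (sym (+-suc i k))))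

flipAt-∈ : ∀ {n} i xs (p : Path n) k → (i + k) ∈ xs → nth (flipAt i xs p) k ≢ just N
flipAt-∈ i xs [] k _ ()
flipAt-∈ i xs (s ∷ p) zero i∈ with any? (i ≟_) xs
... | yes _  = λ ()
... | no i∉ = ⊥-elim (i∉ (subst (_∈ xs) (+-identityʳ i) i∈))
flipAt-∈ i xs (s ∷ p) (suc k) i+k∈ rewrite flipAt-tail i xs s p k =
  flipAt-∈ (suc i) xs p k (subst (_∈ xs) (+-suc i k) i+k∈)

AllPairs-reverse : ∀ {a ℓ} {A : Set a} {R : Rel A ℓ} {xs : List A} → AllPairs R xs → AllPairs (flip R) (reverse xs)
AllPairs-reverse [] = []
AllPairs-reverse {xs = x ∷ xs} (x~xs ∷ xs!) rewrite unfold-reverse x xs =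
  AllPairs.++⁺ (AllPairs-reverse xs!) ([] ∷ [])
    (All.tabulate (λ y∈ → All.lookup x~xs (reverse⁻ y∈) ∷ []))

take-downClosed : ∀ h {L : List ℕ} {x y} → AllPairs _<_ L → y ∈ take h L → x ∈ L → x < y → x ∈ take h L
take-downClosed (suc h) _            (here refl) (here refl) _   = here refl
take-downClosed (suc h) _            (there y∈)  (here refl) _   = here refl
take-downClosed (suc h) (a<L ∷ _)    (here refl) (there x∈) x<a = ⊥-elim (<-asym x<a (All.lookup a<L x∈))
take-downClosed (suc h) (_ ∷ L!)     (there y∈)  (there x∈) x<y = there (take-downClosed h L! y∈ x∈ x<y)

matchStep : ℕ → List ℕ → Step → List ℕ
matchStep i st       N = i ∷ st
matchStep i []       E = []
matchStep i (_ ∷ st) E = st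

scan-∷ : ∀ {m} i st s (p : Path m) → scan i st (s ∷ p) ≡ scan (suc i) (matchStep i st s) p
scan-∷ i st       N p = refl
scan-∷ i []       E p = refl
scan-∷ i (_ ∷ st) E p = refl

-- What the stack st knows after the steps 0 … i-1 of the step sequence Q
-- have been scanned.
record StackInvariant (Q : ℕ → Maybe Step) (i : ℕ) (st : List ℕ) : Set where
  field
    below      : All (_< i) st
    descending : AllPairs _>_ st
    isN        : ∀ {x} → x ∈ st → Q x ≡ just N
    -- property (b), as far as the scanned steps tell
    notBeforeE : ∀ {x} → x ∈ st → suc x ≡ i ⊎ Q (suc x) ≢ just E
    lastN      : ∀ {x} → suc x ≡ i → Q x ≡ just N → x ∈ st
    closedPred : ∀ {x} → suc x ∈ st → Q x ≡ just N → x ∈ st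
open StackInvariant

invariant-start : ∀ Q → StackInvariant Q 0 []
below      (invariant-start Q) = []
descending (invariant-start Q) = []
isN        (invariant-start Q) ()
notBeforeE (invariant-start Q) ()
lastN      (invariant-start Q) ()
closedPred (invariant-start Q) ()

E-at-last : ∀ {Q : ℕ → Maybe Step} {i x} → Q i ≡ just E → suc x ≡ suc i → Q x ≢ just N
E-at-last {Q} Qi≡E 1+x≡1+i Qx≡N with () ← trans (sym Qx≡N) (subst (λ j → Q j ≡ just E) (sym (suc-injective 1+x≡1+i)) Qi≡E)

invariant-push : ∀ {Q i st} → Q i ≡ just N → StackInvariant Q i st → StackInvariant Q (suc i) (i ∷ st)
below      (invariant-push {i = i} q I) = n<1+n i ∷ All.map m<n⇒m<1+n (below I)
descending (invariant-push q I) = below I ∷ descending I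
isN        (invariant-push q I) (here refl) = q
isN        (invariant-push q I) (there x∈)  = isN I x∈
notBeforeE (invariant-push q I) (here refl) = inj₁ refl
notBeforeE (invariant-push q I) (there x∈) with notBeforeE I x∈
... | inj₁ refl = inj₂ λ e → case trans (sym q) e of λ ()
... | inj₂ r    = inj₂ r
lastN      (invariant-push q I) 1+x≡1+i _ = here (suc-injective 1+x≡1+i)
closedPred (invariant-push q I) (here 1+x≡i) Qx = there (lastN I 1+x≡i Qx)
closedPred (invariant-push q I) (there 1+x∈) Qx = there (closedPred I 1+x∈ Qx)

invariant-pop : ∀ {Q i h st} → Q i ≡ just E → StackInvariant Q i (h ∷ st) → StackInvariant Q (suc i) st
below      (invariant-pop q I) with _ ∷ st<i ← below I = All.map m<n⇒m<1+n st<i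
descending (invariant-pop q I) with _ ∷ st! ← descending I = st!
isN        (invariant-pop q I) x∈ = isN I (there x∈)
notBeforeE (invariant-pop q I) x∈ with notBeforeE I (there x∈) | below I | descending I
... | inj₁ 1+x≡i | h<i ∷ _ | st<h ∷ _ = ⊥-elim (<-irrefl 1+x≡i (≤-<-trans (All.lookup st<h x∈) h<i))
... | inj₂ r     | _       | _        = inj₂ r
lastN      (invariant-pop q I) 1+x≡1+i Qx = ⊥-elim (E-at-last q 1+x≡1+i Qx)
closedPred (invariant-pop q I) 1+x∈ Qx with closedPred I (there 1+x∈) Qx | descending I
... | there x∈  | _ = x∈
... | here refl | st<h ∷ _ = ⊥-elim (<-asym (n<1+n _) (All.lookup st<h 1+x∈))

invariant-popEmpty : ∀ {Q i} → Q i ≡ just E → StackInvariant Q i [] → StackInvariant Q (suc i) []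
below      (invariant-popEmpty q I) = []
descending (invariant-popEmpty q I) = []
isN        (invariant-popEmpty q I) ()
notBeforeE (invariant-popEmpty q I) ()
lastN      (invariant-popEmpty q I) 1+x≡1+i Qx = ⊥-elim (E-at-last q 1+x≡1+i Qx)
closedPred (invariant-popEmpty q I) ()

invariant-step : ∀ {Q i st s} → Q i ≡ just s → StackInvariant Q i st → StackInvariant Q (suc i) (matchStep i st s)
invariant-step {st = st}    {N} q I = invariant-push q I
invariant-step {st = []}    {E} q I = invariant-popEmpty q I
invariant-step {st = _ ∷ _} {E} q I = invariant-pop q I

invariant-scan : ∀ Q {m} i st (p : Path m) → (∀ k → nth p k ≡ Q (i + k)) →
                 StackInvariant Q i st → StackInvariant Q (i + m) (scan i st p)
invariant-scan Q i st [] _ I = subst (λ j → StackInvariant Q j st) (sym (+-identityʳ i)) I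
invariant-scan Q {suc m} i st (s ∷ p) suffix I =
  subst₂ (StackInvariant Q) (sym (+-suc i m)) (sym (scan-∷ i st s p))
    (invariant-scan Q (suc i) (matchStep i st s) p suffix′ (invariant-step first I))
  where
  first : Q i ≡ just s
  first = trans (cong Q (sym (+-identityʳ i))) (sym (suffix 0))
  suffix′ : ∀ k → nth p k ≡ Q (suc i + k)
  suffix′ k = trans (suffix (suc k)) (cong Q (+-suc i k))

module _ {n} (P : Path n) where

  private
    final : StackInvariant (nth P) n (scan 0 [] P)
    final = invariant-scan (nth P) 0 [] P (λ _ → refl) (invariant-start (nth P))

  unmatched-isN : ∀ {x} → x ∈ unmatchedN P → nth P x ≡ just N
  unmatched-isN x∈ = isN final (reverse⁻ x∈)

  unmatched-notBeforeE : ∀ {x} → x ∈ unmatchedN P → nth P (suc x) ≢ just E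
  unmatched-notBeforeE x∈ with notBeforeE final (reverse⁻ x∈)
  ... | inj₂ r      = r
  ... | inj₁ 1+x≡n = λ e → case trans (sym (trans (cong (nth P) 1+x≡n) (nth-end P))) e of λ ()

  unmatched-closedPred : ∀ {x} → suc x ∈ unmatchedN P → nth P x ≡ just N → x ∈ unmatchedN P
  unmatched-closedPred 1+x∈ Px = reverse⁺ (closedPred final (reverse⁻ 1+x∈) Px)

  unmatched-increasing : AllPairs _<_ (unmatchedN P)
  unmatched-increasing = AllPairs-reverse (descending final)

module _ {n} (P : Path n) (F : List ℕ)
         (F⊆U : ∀ {x} → x ∈ F → x ∈ unmatchedN P)
         (downClosed : ∀ {x y} → x ∈ unmatchedN P → y ∈ F → x < y → x ∈ F) where

  private
    P′ : Path n
    P′ = flipAt 0 F P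

    NE-preserved : ∀ {m} → NE-at P m → NE-at P′ m
    NE-preserved {m} (Pm , P1+m) = trans (flipAt-∉ 0 F P m m∉) Pm , trans (flipAt-∉ 0 F P (suc m) 1+m∉) P1+m
      where
      m∉ : m ∉ F
      m∉ m∈ = unmatched-notBeforeE P (F⊆U m∈) P1+m
      1+m∉ : suc m ∉ F
      1+m∉ 1+m∈ = case trans (sym (unmatched-isN P (F⊆U 1+m∈))) P1+m of λ ()

    NE-reflected : ∀ {m} → NE-at P′ m → NE-at P m
    NE-reflected {m} (P′m , P′1+m) = Pm , trans (sym (flipAt-∉ 0 F P (suc m) 1+m∉)) P′1+m
      where
      m∉ : m ∉ F
      m∉ m∈ = flipAt-∈ 0 F P m m∈ P′m
      Pm : nth P m ≡ just N
      Pm = trans (sym (flipAt-∉ 0 F P m m∉)) P′m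
      1+m∉ : suc m ∉ F
      1+m∉ 1+m∈ = m∉ (downClosed (unmatched-closedPred P (F⊆U 1+m∈) Pm) 1+m∈ (n<1+n m))

  flipping-preserves-peaks : ∀ i → IsPeak P i ⇔ IsPeak P′ i
  flipping-preserves-peaks zero    = mk⇔ (⊥-elim ∘ noPeakAtOrigin P) (⊥-elim ∘ noPeakAtOrigin P′)
  flipping-preserves-peaks (suc m) =
    ⇔.trans (peak⇔NE P m) (⇔.trans (mk⇔ NE-preserved NE-reflected) (⇔.sym (peak⇔NE P′ m)))

-- Lemma 2.1: ξ flips a prefix of the increasing list of unmatched positions,
-- which is downward closed; so Peak(P) = Peak(ξ(P)).
lemma2p1 : ∀ (n : ℕ) (P : Path n) → IsDyckPrefix P → ∀ (i : ℕ) → IsPeak P i ⇔ IsPeak (ξ P) i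
lemma2p1 n P _ = flipping-preserves-peaks P F (lookup (take-⊆ h U))
                   (λ x∈U y∈F x<y → take-downClosed h (unmatched-increasing P) y∈F x∈U x<y)
  where
  U : List ℕ
  U = unmatchedN P
  h : ℕ
  h = ⌈half⌉ (length U)
  F : List ℕ
  F = take h U
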